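{- Let $\langle B,f,g\rangle$ be a Boolean algebra with modal operators $f,g$ such that $f(x)+g(x)=1$ for all $x\neq0$. Then its canonical extension $\langle 2^{\mathrm{Ult}(B)},\langle R_f\rangle,\langle R_g\rangle\rangle$ also satisfies $\langle R_f\rangle(Y)\cup\langle R_g\rangle(Y)=\mathrm{Ult}(B)$ for every nonempty $Y\subseteq \mathrm{Ult}(B)$.
   Context: A modal operator is $f:B\to B$ with $f(0)=0$, $f(x+y)=f(x)+f(y)$. $\mathrm{Ult}(B)$ is the set of ultrafilters of $B$; $F R_f G$ iff $\{f(a):a\in G\}\subseteq F$. For a relation $R$ on $X$ and $Y\subseteq X$, $\langle R\rangle(Y)=\{x:\exists y\in Y,\ xRy\}$. -}

module Defs where

open import Level using (Level; _⊔_; suc)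
open import Algebra.Lattice.Bundles using (BooleanAlgebra)
open import Data.Product using (Σ; _×_; ∃)
open import Data.Sum using (_⊎_)
open import Relation.Nullary using (¬_)

module _ {c ℓ : Level} (B : BooleanAlgebra c ℓ) where
  open BooleanAlgebra B renaming (¬_ to compl)

  record IsModalOperator (f : Carrier → Carrier) : Set (c ⊔ ℓ) where
    field
      cong    : ∀ {x y} → x ≈ y → f x ≈ f y
      f-⊥     : f ⊥ ≈ ⊥
      f-∨     : ∀ x y → f (x ∨ y) ≈ f x ∨ f y

  record Ultrafilter (p : Level) : Set (c ⊔ ℓ ⊔ suc p) where
    field
      _∋_      : Carrier → Set p
      resp     : ∀ {a b} → a ≈ b → _∋_ a → _∋_ b
      up       : ∀ {a b} → _∋_ a → a ∧ b ≈ a → _∋_ b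
      has-⊤    : _∋_ ⊤
      meet     : ∀ {a b} → _∋_ a → _∋_ b → _∋_ (a ∧ b)
      proper   : ¬ (_∋_ ⊥)
      ultra    : ∀ a → _∋_ a ⊎ _∋_ (compl a)

  open Ultrafilter public

  R[_] : ∀ {p} → (Carrier → Carrier) → Ultrafilter p → Ultrafilter p → Set (c ⊔ p)
  R[ f ] F G = ∀ a → G ∋ a → F ∋ f a

⟨_⟩ : ∀ {a r q} {X : Set a} → (X → X → Set r) → (X → Set q) → X → Set (a ⊔ r ⊔ q)
⟨ R ⟩ Y x = ∃ λ y → Y y × R x y

module Submission where

open import Defs
open import Level using (Level; _⊔_; Lift; lift; lower)
open import Algebra.Lattice.Bundles using (BooleanAlgebra)
import Algebra.Lattice.Properties.BooleanAlgebra as BooleanAlgebraProperties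
open import Axiom.ExcludedMiddle using (ExcludedMiddle)
open import Data.Empty using (⊥-elim)
open import Data.Product using (∃; _,_)
open import Data.Sum using (_⊎_; inj₁; inj₂; [_,_]′)
open import Function using (id)
open import Relation.Nullary using (¬_; Dec; yes; no)
open import Relation.Nullary.Decidable using (map′)

-- Fix G ∈ Y.  If F R_f G and F R_g G both failed, there would be a, b ∈ G
-- with f a ∉ F and g b ∉ F.  Then a ∧ b ∈ G is nonzero, so
-- f (a ∧ b) ∨ g (a ∧ b) = ⊤ ∈ F, and by primality of F and monotonicity of
-- the operators f a ∈ F or g b ∈ F.  Excluded middle is needed only to
-- decide whether F R_g G holds.

module _ {c ℓ} (B : BooleanAlgebra c ℓ) where
  open BooleanAlgebra B renaming (¬_ to compl)
  open BooleanAlgebraProperties B using (deMorgan₂)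

  modal-monotone : ∀ {h} → IsModalOperator B h →
                   ∀ {x y} → x ∨ y ≈ y → h x ∨ h y ≈ h y
  modal-monotone {h} H {x} {y} x≤y = trans (sym (f-∨ x y)) (cong x≤y)
    where open IsModalOperator H

  x∧y≤x : ∀ x y → (x ∧ y) ∨ x ≈ x
  x∧y≤x x y = trans (∨-comm (x ∧ y) x) (∨-absorbs-∧ x y)

  x∧y≤y : ∀ x y → (x ∧ y) ∨ y ≈ y
  x∧y≤y x y = trans (∨-congʳ (∧-comm x y)) (x∧y≤x y x)

  module _ {p} (F : Ultrafilter B p) where

    ∋-upward : ∀ {x y} → F ∋ x → x ∨ y ≈ y → F ∋ y
    ∋-upward {x} {y} x∈F x≤y = up F x∈F (trans (∧-congˡ (sym x≤y)) (∧-absorbs-∨ x y))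

    ∋⇒≉⊥ : ∀ {x} → F ∋ x → ¬ x ≈ ⊥
    ∋⇒≉⊥ x∈F x≈⊥ = proper F (resp F x≈⊥ x∈F)

    ∋-compl⇒∌ : ∀ {x} → F ∋ compl x → ¬ F ∋ x
    ∋-compl⇒∌ {x} x̅∈F x∈F = ∋⇒≉⊥ (meet F x∈F x̅∈F) (∧-complementʳ x)

    ∌-compl⇒∋ : ∀ {x} → ¬ F ∋ compl x → F ∋ x
    ∌-compl⇒∋ {x} x̅∉F = [ id , (λ x̅∈F → ⊥-elim (x̅∉F x̅∈F)) ]′ (ultra F x)

    ∋-∨-prime : ∀ {x y} → F ∋ (x ∨ y) → F ∋ x ⊎ F ∋ y
    ∋-∨-prime {x} {y} x∨y∈F with ultra F x | ultra F y
    ... | inj₁ x∈F | _        = inj₁ x∈F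
    ... | inj₂ _   | inj₁ y∈F = inj₂ y∈F
    ... | inj₂ x̅∈F | inj₂ y̅∈F =
      ⊥-elim (∋-compl⇒∌ (resp F (sym (deMorgan₂ x y)) (meet F x̅∈F y̅∈F)) x∨y∈F)

  module _ {f g} (Hf : IsModalOperator B f) (Hg : IsModalOperator B g)
           (covering : ∀ x → ¬ x ≈ ⊥ → f x ∨ g x ≈ ⊤)
           {p} (F G : Ultrafilter B p) where

    compl-images-clash : ∀ {a b} → G ∋ a → G ∋ b →
                         F ∋ compl (f a) → ¬ F ∋ compl (g b)
    compl-images-clash {a} {b} a∈G b∈G fa̅∈F gb̅∈F
      with ∋-∨-prime F (resp F (sym (covering (a ∧ b) a∧b≉⊥)) (has-⊤ F))
      where a∧b≉⊥ = ∋⇒≉⊥ G (meet G a∈G b∈G)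
    ... | inj₁ fab∈F = ∋-compl⇒∌ F fa̅∈F (∋-upward F fab∈F (modal-monotone Hf (x∧y≤x a b)))
    ... | inj₂ gab∈F = ∋-compl⇒∌ F gb̅∈F (∋-upward F gab∈F (modal-monotone Hg (x∧y≤y a b)))

    R-dichotomy : Dec (R[_] B g F G) → R[_] B f F G ⊎ R[_] B g F G
    R-dichotomy (yes FRgG) = inj₂ FRgG
    R-dichotomy (no ¬FRgG) = inj₁ λ a a∈G → ∌-compl⇒∋ F λ fa̅∈F →
      ¬FRgG λ b b∈G → ∌-compl⇒∋ F (compl-images-clash a∈G b∈G fa̅∈F)

mainTheorem13 : ∀ {c ℓ p q : Level} → ExcludedMiddle (c ⊔ ℓ ⊔ p ⊔ q) →
    (B : BooleanAlgebra c ℓ) →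
    (f g : BooleanAlgebra.Carrier B → BooleanAlgebra.Carrier B) →
    IsModalOperator B f → IsModalOperator B g →
    (∀ x → ¬ (BooleanAlgebra._≈_ B x (BooleanAlgebra.⊥ B)) →
      BooleanAlgebra._≈_ B (BooleanAlgebra._∨_ B (f x) (g x)) (BooleanAlgebra.⊤ B)) →
    (Y : Ultrafilter B p → Set q) → ∃ Y →
    ∀ F → ⟨ R[_] B f ⟩ Y F ⊎ ⟨ R[_] B g ⟩ Y F
mainTheorem13 {c} {ℓ} {p} {q} em B f g Hf Hg covering Y (G , G∈Y) F
  with R-dichotomy B Hf Hg covering F G (map′ lower lift (em {Lift (c ⊔ ℓ ⊔ p ⊔ q) _}))
... | inj₁ FRfG = inj₁ (G , G∈Y , FRfG)
... | inj₂ FRgG = inj₂ (G , G∈Y , FRgG)
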